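{- Each of the following subsets of $\mathbb{Z}$ is unstable in $(\mathbb{Z},+)$ (i.e. for every $N$ there are $a_0,\ldots,a_N,b_0,\ldots,b_N\in\mathbb{Z}$ with $a_i+b_j\in A\iff i\le j$): (i) for an integer $d>2$, the set of $a\in\mathbb{Z}$ whose canonical base-$d$ representation ends in $1$ or $-1$; (ii) for an integer $d>2$, the set of $a\in\mathbb{Z}$ whose canonical base-$d$ representation does not contain the digit $0$; (iii) for an integer $d\ge2$, the set of $a\in\mathbb{Z}$ whose canonical base-$d$ representation has even length; (iv) the set of $a\in\mathbb{Z}$ whose canonical base-$2$ representation has the form $0^{k_0}10^{k_1}1\cdots10^{k_m}1$ or $0^{k_0}(-1)0^{k_1}(-1)\cdots(-1)0^{k_m}(-1)$ for some $m\ge 0$ and even $k_0,\ldots,k_m\ge0$.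
   Context: The canonical base-$d$ representation of $0$ is the empty word; of $a>0$ it is the usual base-$d$ digit string $k_0k_1\cdots k_n$ with $a=\sum_ik_id^i$, $k_i\in\{0,\ldots,d-1\}$, $k_n\neq0$, written least significant digit first (so "ends in" refers to the most significant digit $k_n$); of $a<0$ it is $(-k_0)\cdots(-k_n)$ where $k_0\cdots k_n$ is the canonical representation of $-a$. $0^k$ denotes $k$ consecutive zeros. -}

module Defs where

open import Data.Nat as ℕ using (ℕ; zero; suc; _%_; _/_)
open import Data.Nat.Divisibility using (_∣_)
open import Data.Integer as ℤ using (ℤ; +_; -[1+_]; -_; 0ℤ)
open import Data.Fin using (Fin; toℕ)
open import Data.List using (List; []; _∷_; map; replicate; _++_; [_])
open import Data.Product using (Σ; _×_)
open import Function.Bundles using (_⇔_)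

-- Canonical base-(suc k) digits (least significant first) of a natural number,
-- computed with fuel; fuel = a suffices whenever the base is ≥ 2.
digitsFuel : ℕ → (k : ℕ) → ℕ → List ℕ
digitsFuel zero    k a       = []
digitsFuel (suc f) k zero    = []
digitsFuel (suc f) k (suc a) = (suc a % suc k) ∷ digitsFuel f k (suc a / suc k)

-- canonical base-d representation of a ∈ ℕ (junk [] for d = 0; only used for d ≥ 2)
repℕ : ℕ → ℕ → List ℕ
repℕ zero    a = []
repℕ (suc k) a = digitsFuel a k a

-- canonical base-d representation of an integer, digits in ℤ;
-- for a < 0 it is the digitwise negation of the representation of -a
rep : ℕ → ℤ → List ℤ
rep d (+ n)      = map +_ (repℕ d n)
rep d -[1+ n ]   = map (λ k → - (+ k)) (repℕ d (suc n))

Unstable : (ℤ → Set) → Set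
Unstable A = (N : ℕ) → Σ (Fin (suc N) → ℤ) λ a → Σ (Fin (suc N) → ℤ) λ b →
  (i j : Fin (suc N)) → (A (a i ℤ.+ b j) ⇔ (toℕ i ℕ.≤ toℕ j))

data Blocks (s : ℤ) : List ℤ → Set where
  one  : (k : ℕ) → 2 ∣ k → Blocks s (replicate k 0ℤ ++ [ s ])
  more : (k : ℕ) {L : List ℤ} → 2 ∣ k → Blocks s L → Blocks s (replicate k 0ℤ ++ (s ∷ L))

module Submission where

-- Each set A in the corollary is shown unstable by exhibiting one infinite
-- half-graph: sequences a, b : ℕ → ℤ with A (a i + b j) ⇔ i ≤ j.  Writing
-- i ≤ j as j = i + k and i > j as i = j + 1 + k, it suffices that A holds on
-- every sum of the first kind and fails on every sum of the second kind.
--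
-- For (i), (iii), (iv) we take a i = d^(2i)·x and b j = d^(2j+1)·y with two
-- nonzero digits x, y.  Then a i + b j has the base-d word 0^(2i) x 0^(2k) y
-- when j = i + k, and 0^(2j+1) y 0^(2k) x when i = j + 1 + k: the order of the
-- two digits, the parity of the leading run of zeros and the parity of the
-- length all record whether i ≤ j.  For (ii) we take a i = d^(2i) and b j the
-- repunit 1^(2j+1): the sum has word 1^(2i) 2 1^(2k), or 1^(2j+1) 0^(2k+1) 1.

open import Defs
open import Data.Nat using (ℕ; zero; suc; _+_; _*_; _^_; _%_; _/_; _<_; _≤_; z≤n; s≤s; NonZero)
open import Data.Nat.Properties
open import Data.Nat.DivMod using ([m+kn]%n≡m%n; m<n⇒m%n≡m; +-distrib-/-∣ʳ; m<n⇒m/n≡0; m*n/n≡m; m/n<m)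
open import Data.Nat.Divisibility using (_∣_; divides; divides-refl; ∣m+n∣m⇒∣n; ∣1⇒≡1)
open import Data.Nat.Tactic.RingSolver using (solve-∀)
open import Data.Integer as ℤ using (ℤ; +_; 0ℤ; 1ℤ; -1ℤ)
-- The embedding ℕ → ℤ under a name usable as an argument of map (a bare +_
-- would be read as a section of ℕ's addition).
open import Data.Integer.Base using () renaming (+_ to toℤ)
open import Data.List using (List; []; _∷_; _++_; [_]; replicate; map; last; length)
open import Data.List.Properties using (map-++; map-replicate; length-++; length-replicate; ++-assoc; ∷-injectiveˡ; ∷-injectiveʳ)
open import Data.List.Relation.Unary.All as All using (All; []; _∷_)
open import Data.List.Relation.Unary.All.Properties using (++⁺; ++⁻ʳ; replicate⁺; map⁺; map⁻)
open import Data.Maybe using (just)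
open import Data.Product using (_×_; _,_; proj₁; proj₂; map₁)
open import Data.Sum using (_⊎_; inj₁; inj₂)
open import Data.Empty using (⊥-elim)
open import Data.Fin using (toℕ)
open import Function using (_∘_)
open import Function.Bundles using (_⇔_; mk⇔)
open import Relation.Nullary using (¬_)
open import Relation.Binary.PropositionalEquality using (_≡_; _≢_; refl; sym; trans; cong; cong₂; subst; module ≡-Reasoning)

open ≡-Reasoning

val : ℕ → List ℕ → ℕ
val d []       = 0
val d (x ∷ xs) = x + d * val d xs

val-++ : ∀ d xs ys → val d (xs ++ ys) ≡ val d xs + d ^ length xs * val d ys
val-++ d []       ys = sym (+-identityʳ (val d ys))
val-++ d (x ∷ xs) ys = begin
  x + d * val d (xs ++ ys)                          ≡⟨ cong (λ v → x + d * v) (val-++ d xs ys) ⟩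
  x + d * (val d xs + d ^ length xs * val d ys)     ≡⟨ distribute d x (val d xs) (d ^ length xs) (val d ys) ⟩
  x + d * val d xs + d * d ^ length xs * val d ys   ∎
  where
  distribute : ∀ d x v p w → x + d * (v + p * w) ≡ x + d * v + d * p * w
  distribute = solve-∀

val-shift : ∀ d p L → val d (replicate p 0 ++ L) ≡ d ^ p * val d L
val-shift d zero    L = sym (*-identityˡ (val d L))
val-shift d (suc p) L = begin
  d * val d (replicate p 0 ++ L)   ≡⟨ cong (d *_) (val-shift d p L) ⟩
  d * (d ^ p * val d L)            ≡⟨ sym (*-assoc d (d ^ p) (val d L)) ⟩
  d * d ^ p * val d L              ∎

val-monomial : ∀ d p y → val d (replicate p 0 ++ [ y ]) ≡ d ^ p * y
val-monomial d p y = begin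
  val d (replicate p 0 ++ [ y ])   ≡⟨ val-shift d p [ y ] ⟩
  d ^ p * (y + d * 0)              ≡⟨ cong (λ z → d ^ p * (y + z)) (*-zeroʳ d) ⟩
  d ^ p * (y + 0)                  ≡⟨ cong (d ^ p *_) (+-identityʳ y) ⟩
  d ^ p * y                        ∎

val-bump : ∀ d xs y ys → val d (xs ++ suc y ∷ ys) ≡ d ^ length xs + val d (xs ++ y ∷ ys)
val-bump d []       y ys = refl
val-bump d (x ∷ xs) y ys = begin
  x + d * val d (xs ++ suc y ∷ ys)                   ≡⟨ cong (λ v → x + d * v) (val-bump d xs y ys) ⟩
  x + d * (d ^ length xs + val d (xs ++ y ∷ ys))     ≡⟨ regroup d x (d ^ length xs) (val d (xs ++ y ∷ ys)) ⟩
  d * d ^ length xs + (x + d * val d (xs ++ y ∷ ys)) ∎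
  where
  regroup : ∀ d x p w → x + d * (p + w) ≡ d * p + (x + d * w)
  regroup = solve-∀

-- A nonempty word of base-d digits whose most significant digit is nonzero:
-- exactly the words produced by repℕ d on positive numbers.
data Canonical⁺ (d : ℕ) : List ℕ → Set where
  top : ∀ {x} → 0 < x → x < d → Canonical⁺ d [ x ]
  _∷_ : ∀ {x xs} → x < d → Canonical⁺ d xs → Canonical⁺ d (x ∷ xs)

prepend : ∀ {d xs L} → All (_< d) xs → Canonical⁺ d L → Canonical⁺ d (xs ++ L)
prepend []         c = c
prepend (x<d ∷ ps) c = x<d ∷ prepend ps c

nonzero-canonical : ∀ {d x xs} → All (λ y → 0 < y × y < d) (x ∷ xs) → Canonical⁺ d (x ∷ xs)
nonzero-canonical ((0<x , x<d) ∷ [])      = top 0<x x<d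
nonzero-canonical ((_ , x<d) ∷ (q ∷ qs)) = x<d ∷ nonzero-canonical (q ∷ qs)

val-positive : ∀ {d L} → Canonical⁺ d L → 0 < val d L
val-positive {d} (top {x} 0<x _) = ≤-trans 0<x (m≤m+n x (d * 0))
val-positive {d} (_∷_ {x} {xs} x<d c) =
  ≤-trans (*-mono-< (≤-trans (s≤s z≤n) x<d) (val-positive c)) (m≤n+m (d * val d xs) x)

%-digit : ∀ {d x} v .{{_ : NonZero d}} → x < d → (x + d * v) % d ≡ x
%-digit {d} {x} v x<d = begin
  (x + d * v) % d   ≡⟨ cong (λ m → (x + m) % d) (*-comm d v) ⟩
  (x + v * d) % d   ≡⟨ [m+kn]%n≡m%n x v d ⟩
  x % d             ≡⟨ m<n⇒m%n≡m x<d ⟩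
  x                 ∎

/-digit : ∀ {d x} v .{{_ : NonZero d}} → x < d → (x + d * v) / d ≡ v
/-digit {d} {x} v x<d = begin
  (x + d * v) / d         ≡⟨ cong (λ m → (x + m) / d) (*-comm d v) ⟩
  (x + v * d) / d         ≡⟨ +-distrib-/-∣ʳ x (divides-refl v) ⟩
  x / d + v * d / d       ≡⟨ cong₂ _+_ (m<n⇒m/n≡0 x<d) (m*n/n≡m v d) ⟩
  v                       ∎

-- In base ≥ 2 the quotient of a positive number is smaller than it, so any
-- fuel at least n computes the same digits of n.
digitsFuel-irrelevant : ∀ {k} f g n → n ≤ f → n ≤ g → digitsFuel f (suc k) n ≡ digitsFuel g (suc k) n
digitsFuel-irrelevant zero    zero    zero    _ _ = refl
digitsFuel-irrelevant zero    (suc g) zero    _ _ = refl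
digitsFuel-irrelevant (suc f) zero    zero    _ _ = refl
digitsFuel-irrelevant (suc f) (suc g) zero    _ _ = refl
digitsFuel-irrelevant {k} (suc f) (suc g) (suc n) (s≤s n≤f) (s≤s n≤g) =
  cong (_ ∷_) (digitsFuel-irrelevant f g _ (≤-trans q≤n n≤f) (≤-trans q≤n n≤g))
  where
  q≤n : suc n / suc (suc k) ≤ n
  q≤n = ≤-pred (m/n<m (suc n) (suc (suc k)) (s≤s (s≤s z≤n)))

repℕ-positive : ∀ {k} n → 0 < n →
  repℕ (suc (suc k)) n ≡ n % suc (suc k) ∷ repℕ (suc (suc k)) (n / suc (suc k))
repℕ-positive {k} (suc n) _ =
  cong (suc n % d ∷_) (digitsFuel-irrelevant n (suc n / d) (suc n / d) q≤n ≤-refl)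
  where
  d = suc (suc k)
  q≤n : suc n / d ≤ n
  q≤n = ≤-pred (m/n<m (suc n) d (s≤s (s≤s z≤n)))

repℕ-cons : ∀ {k x} v → x < suc (suc k) → 0 < x + suc (suc k) * v →
  repℕ (suc (suc k)) (x + suc (suc k) * v) ≡ x ∷ repℕ (suc (suc k)) v
repℕ-cons v x<d pos =
  trans (repℕ-positive _ pos) (cong₂ _∷_ (%-digit v x<d) (cong (repℕ _) (/-digit v x<d)))

repℕ-val : ∀ {d L} → 2 ≤ d → Canonical⁺ d L → repℕ d (val d L) ≡ L
repℕ-val {suc (suc k)} (s≤s (s≤s z≤n)) c@(top _ x<d) = repℕ-cons 0 x<d (val-positive c)
repℕ-val {suc (suc k)} 2≤d@(s≤s (s≤s z≤n)) c@(_∷_ {x} {xs} x<d c′) =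
  trans (repℕ-cons (val _ xs) x<d (val-positive c)) (cong (x ∷_) (repℕ-val 2≤d c′))

rep-val : ∀ {d L} → 2 ≤ d → Canonical⁺ d L → rep d (+ val d L) ≡ map toℤ L
rep-val 2≤d c = cong (map toℤ) (repℕ-val 2≤d c)

data LeOrGt : ℕ → ℕ → Set where
  le : ∀ i k → LeOrGt i (i + k)
  gt : ∀ j k → LeOrGt (j + suc k) j

le-or-gt : ∀ i j → LeOrGt i j
le-or-gt zero    j       = le zero j
le-or-gt (suc i) zero    = gt zero i
le-or-gt (suc i) (suc j) with le-or-gt i j
... | le .i k = le (suc i) k
... | gt .j k = gt (suc j) k

unstable-from-half-graph : ∀ {A : ℤ → Set} (a b : ℕ → ℤ) →
  (∀ i k → A (a i ℤ.+ b (i + k))) → (∀ j k → ¬ A (a (j + suc k) ℤ.+ b j)) → Unstable A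
unstable-from-half-graph {A} a b holds fails N =
  a ∘ toℕ , b ∘ toℕ , λ i j → half-graph (toℕ i) (toℕ j)
  where
  half-graph : ∀ i j → A (a i ℤ.+ b j) ⇔ i ≤ j
  half-graph i j with le-or-gt i j
  ... | le .i k = mk⇔ (λ _ → m≤m+n i k) (λ _ → holds i k)
  ... | gt .j k = mk⇔ (⊥-elim ∘ fails j k) (⊥-elim ∘ m+1+n≰m j)

-- 2(i+k)+1 = 2i + (2k+1): the exponents of the second digit when i ≤ j.
even-split : ∀ i k → suc ((i + k) + (i + k)) ≡ (i + i) + suc (k + k)
even-split = solve-∀

-- 2(j+1+k) = (2j+1) + (2k+1): the exponents of the second digit when i > j.
odd-split : ∀ j k → (j + suc k) + (j + suc k) ≡ suc (j + j) + suc (k + k)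
odd-split = solve-∀

spaced : ∀ {A : Set} → A → ℕ → A → ℕ → A → List A
spaced z p x q y = replicate p z ++ x ∷ replicate q z ++ [ y ]

map-spaced : ∀ {A B : Set} (f : A → B) z p x q y → map f (spaced z p x q y) ≡ spaced (f z) p (f x) q (f y)
map-spaced f z p x q y = begin
  map f (replicate p z ++ x ∷ replicate q z ++ [ y ])           ≡⟨ map-++ f (replicate p z) _ ⟩
  map f (replicate p z) ++ f x ∷ map f (replicate q z ++ [ y ]) ≡⟨ cong₂ (λ u v → u ++ f x ∷ v) (map-replicate f p z) inner ⟩
  replicate p (f z) ++ f x ∷ replicate q (f z) ++ [ f y ]       ∎
  where
  inner : map f (replicate q z ++ [ y ]) ≡ replicate q (f z) ++ [ f y ]
  inner = trans (map-++ f (replicate q z) [ y ]) (cong (_++ [ f y ]) (map-replicate f q z))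

last-snoc : ∀ {A : Set} (xs : List A) y → last (xs ++ [ y ]) ≡ just y
last-snoc []            y = refl
last-snoc (_ ∷ [])      y = refl
last-snoc (_ ∷ x ∷ xs)  y = last-snoc (x ∷ xs) y

last-spaced : ∀ {A : Set} (z : A) p x q y → last (spaced z p x q y) ≡ just y
last-spaced z p x q y =
  trans (cong last (sym (++-assoc (replicate p z) (x ∷ replicate q z) [ y ]))) (last-snoc (replicate p z ++ x ∷ replicate q z) y)

length-spaced : ∀ {A : Set} (z : A) p x q y → length (spaced z p x q y) ≡ p + suc (q + 1)
length-spaced z p x q y = begin
  length (replicate p z ++ x ∷ replicate q z ++ [ y ])        ≡⟨ length-++ (replicate p z) ⟩
  length (replicate p z) + suc (length (replicate q z ++ [ y ])) ≡⟨ cong₂ (λ m n → m + suc n) (length-replicate p) inner ⟩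
  p + suc (q + 1)                                             ∎
  where
  inner : length (replicate q z ++ [ y ]) ≡ q + 1
  inner = trans (length-++ (replicate q z)) (cong (_+ 1) (length-replicate q))

val-spaced : ∀ d p x q y → val d (spaced 0 p x q y) ≡ d ^ p * x + d ^ (p + suc q) * y
val-spaced d p x q y = begin
  val d (replicate p 0 ++ x ∷ replicate q 0 ++ [ y ])  ≡⟨ val-shift d p _ ⟩
  d ^ p * (x + d * val d (replicate q 0 ++ [ y ]))     ≡⟨ cong (λ v → d ^ p * (x + d * v)) (val-monomial d q y) ⟩
  d ^ p * (x + d * (d ^ q * y))                        ≡⟨ expand (d ^ p) d (d ^ q) x y ⟩
  d ^ p * x + d ^ p * (d * d ^ q) * y                  ≡⟨ cong (λ e → d ^ p * x + e * y) (sym (^-distribˡ-+-* d p (suc q))) ⟩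
  d ^ p * x + d ^ (p + suc q) * y                      ∎
  where
  expand : ∀ P d Q x y → P * (x + d * (Q * y)) ≡ P * x + P * (d * Q) * y
  expand = solve-∀

rep-two-digits : ∀ {d x y} p q → 2 ≤ d → x < d → 0 < y → y < d →
  rep d (+ (d ^ p * x + d ^ (p + suc q) * y)) ≡ spaced 0ℤ p (+ x) q (+ y)
rep-two-digits {d} {x} {y} p q 2≤d x<d 0<y y<d = begin
  rep d (+ (d ^ p * x + d ^ (p + suc q) * y))  ≡⟨ cong (rep d ∘ toℤ) (sym (val-spaced d p x q y)) ⟩
  rep d (+ val d (spaced 0 p x q y))           ≡⟨ rep-val 2≤d canonical ⟩
  map toℤ (spaced 0 p x q y)                   ≡⟨ map-spaced toℤ 0 p x q y ⟩
  spaced 0ℤ p (+ x) q (+ y)                    ∎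
  where
  0<d = ≤-trans (s≤s z≤n) y<d
  canonical : Canonical⁺ d (spaced 0 p x q y)
  canonical = prepend (replicate⁺ p 0<d) (x<d ∷ prepend (replicate⁺ q 0<d) (top 0<y y<d))

two-digit-unstable : (P : List ℤ → Set) {d x y : ℕ} → 2 ≤ d → 0 < x → x < d → 0 < y → y < d →
  (∀ i k → P (spaced 0ℤ (i + i) (+ x) (k + k) (+ y))) →
  (∀ j k → ¬ P (spaced 0ℤ (suc (j + j)) (+ y) (k + k) (+ x))) →
  Unstable (λ a → P (rep d a))
two-digit-unstable P {d} {x} {y} 2≤d 0<x x<d 0<y y<d holds fails =
  unstable-from-half-graph {λ a → P (rep d a)} (λ i → + (d ^ (i + i) * x)) (λ j → + (d ^ suc (j + j) * y)) holds′ fails′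
  where
  holds′ : ∀ i k → P (rep d (+ (d ^ (i + i) * x + d ^ suc ((i + k) + (i + k)) * y)))
  holds′ i k = subst P (sym word) (holds i k)
    where
    word : rep d (+ (d ^ (i + i) * x + d ^ suc ((i + k) + (i + k)) * y)) ≡ spaced 0ℤ (i + i) (+ x) (k + k) (+ y)
    word = trans (cong (λ e → rep d (+ (d ^ (i + i) * x + d ^ e * y))) (even-split i k))
                 (rep-two-digits (i + i) (k + k) 2≤d x<d 0<y y<d)
  fails′ : ∀ j k → ¬ P (rep d (+ (d ^ ((j + suc k) + (j + suc k)) * x + d ^ suc (j + j) * y)))
  fails′ j k = fails j k ∘ subst P word
    where
    sum : d ^ ((j + suc k) + (j + suc k)) * x + d ^ suc (j + j) * y ≡ d ^ suc (j + j) * y + d ^ (suc (j + j) + suc (k + k)) * x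
    sum = trans (+-comm (d ^ ((j + suc k) + (j + suc k)) * x) (d ^ suc (j + j) * y)) (cong (λ e → d ^ suc (j + j) * y + d ^ e * x) (odd-split j k))
    word : rep d (+ (d ^ ((j + suc k) + (j + suc k)) * x + d ^ suc (j + j) * y)) ≡ spaced 0ℤ (suc (j + j)) (+ y) (k + k) (+ x)
    word = trans (cong (rep d ∘ toℤ) sum) (rep-two-digits (suc (j + j)) (k + k) 2≤d y<d 0<x x<d)

even : ∀ m → 2 ∣ m + m
even m = divides m (trans (cong (λ n → m + n) (sym (+-identityʳ m))) (*-comm 2 m))

odd-not-even : ∀ m → ¬ 2 ∣ suc (m + m)
odd-not-even m 2∣odd with ∣1⇒≡1 (∣m+n∣m⇒∣n (subst (2 ∣_) (+-comm 1 (m + m)) 2∣odd) (even m))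
... | ()

leading-run-unique : ∀ {A : Set} {z s x : A} k p {X Y} → s ≢ z → x ≢ z →
  replicate k z ++ s ∷ X ≡ replicate p z ++ x ∷ Y → k ≡ p × s ≡ x
leading-run-unique zero    zero    _   _   eq = refl , ∷-injectiveˡ eq
leading-run-unique zero    (suc p) s≢z _   eq = ⊥-elim (s≢z (∷-injectiveˡ eq))
leading-run-unique (suc k) zero    _   x≢z eq = ⊥-elim (x≢z (sym (∷-injectiveˡ eq)))
leading-run-unique (suc k) (suc p) s≢z x≢z eq =
  map₁ (cong suc) (leading-run-unique k p s≢z x≢z (∷-injectiveʳ eq))

blocks-leading-zeros : ∀ {s x : ℤ} p L → s ≢ 0ℤ → x ≢ 0ℤ →
  Blocks s (replicate p 0ℤ ++ x ∷ L) → 2 ∣ p × s ≡ x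
blocks-leading-zeros p L s≢0 x≢0 b = leading b refl
  where
  leading : ∀ {M} → Blocks _ M → M ≡ replicate p 0ℤ ++ _ ∷ L → 2 ∣ p × _ ≡ _
  leading (one k 2∣k)    eq = map₁ (λ k≡p → subst (2 ∣_) k≡p 2∣k) (leading-run-unique k p s≢0 x≢0 eq)
  leading (more k 2∣k _) eq = map₁ (λ k≡p → subst (2 ∣_) k≡p 2∣k) (leading-run-unique k p s≢0 x≢0 eq)

-- (i) In base d > 2, "the last digit is ±1" separates 0^(2i) 2 0^(2k) 1 from
-- 0^(2j+1) 1 0^(2k) 2.
last-digit-unstable : (d : ℕ) → 2 < d → Unstable (λ a → (last (rep d a) ≡ just 1ℤ) ⊎ (last (rep d a) ≡ just -1ℤ))
last-digit-unstable d 2<d =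
  two-digit-unstable (λ L → last L ≡ just 1ℤ ⊎ last L ≡ just -1ℤ) 2≤d (s≤s z≤n) 2<d (s≤s z≤n) 2≤d holds fails
  where
  2≤d = <⇒≤ 2<d
  holds : ∀ i k → last (spaced 0ℤ (i + i) (+ 2) (k + k) 1ℤ) ≡ just 1ℤ ⊎ _
  holds i k = inj₁ (last-spaced 0ℤ (i + i) (+ 2) (k + k) 1ℤ)
  fails : ∀ j k → ¬ (last (spaced 0ℤ (suc (j + j)) 1ℤ (k + k) (+ 2)) ≡ just 1ℤ ⊎ _)
  fails j k = two≢±1 ∘ subst (λ m → m ≡ just 1ℤ ⊎ m ≡ just -1ℤ) (last-spaced 0ℤ (suc (j + j)) 1ℤ (k + k) (+ 2))
    where
    two≢±1 : ¬ (just (+ 2) ≡ just 1ℤ ⊎ just (+ 2) ≡ just -1ℤ)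
    two≢±1 (inj₁ ())
    two≢±1 (inj₂ ())

replicate-split : ∀ {A : Set} m n (x : A) → replicate (m + suc n) x ≡ replicate m x ++ x ∷ replicate n x
replicate-split zero    n x = refl
replicate-split (suc m) n x = cong (x ∷_) (replicate-split m n x)

NonzeroDigits : List ℤ → Set
NonzeroDigits = All (λ k → k ≢ 0ℤ)

nonzero-digits-unstable : (d : ℕ) → 2 < d → Unstable (λ a → NonzeroDigits (rep d a))
nonzero-digits-unstable d 2<d =
  unstable-from-half-graph {λ a → NonzeroDigits (rep d a)}
    (λ i → + (d ^ (i + i))) (λ j → + val d (replicate (suc (j + j)) 1)) holds fails
  where
  2≤d = <⇒≤ 2<d
  1<d : 1 < d
  1<d = 2≤d
  0<d = ≤-trans (s≤s z≤n) 2≤d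
  holds : ∀ i k → NonzeroDigits (rep d (+ (d ^ (i + i) + val d (replicate (suc ((i + k) + (i + k))) 1))))
  holds i k = subst NonzeroDigits (cong (rep d ∘ toℤ) value) (subst NonzeroDigits (sym (rep-val 2≤d canonical)) nonzero)
    where
    word = replicate (i + i) 1 ++ 2 ∷ replicate (k + k) 1
    canonical : Canonical⁺ d word
    canonical = prepend (replicate⁺ (i + i) 1<d) (nonzero-canonical ((s≤s z≤n , 2<d) ∷ replicate⁺ (k + k) (s≤s z≤n , 1<d)))
    nonzero : NonzeroDigits (map toℤ word)
    nonzero = map⁺ (++⁺ (replicate⁺ (i + i) (λ ())) ((λ ()) ∷ replicate⁺ (k + k) (λ ())))
    value : val d word ≡ d ^ (i + i) + val d (replicate (suc ((i + k) + (i + k))) 1)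
    value = begin
      val d word                                                         ≡⟨ val-bump d (replicate (i + i) 1) 1 (replicate (k + k) 1) ⟩
      d ^ length (replicate (i + i) 1) + val d (replicate (i + i) 1 ++ 1 ∷ replicate (k + k) 1)
        ≡⟨ cong₂ (λ n M → d ^ n + val d M) (length-replicate (i + i)) (sym (replicate-split (i + i) (k + k) 1)) ⟩
      d ^ (i + i) + val d (replicate ((i + i) + suc (k + k)) 1)         ≡⟨ cong (λ n → d ^ (i + i) + val d (replicate n 1)) (sym (even-split i k)) ⟩
      d ^ (i + i) + val d (replicate (suc ((i + k) + (i + k))) 1)      ∎
  fails : ∀ j k → ¬ NonzeroDigits (rep d (+ (d ^ ((j + suc k) + (j + suc k)) + val d (replicate (suc (j + j)) 1))))
  fails j k h = All.head (++⁻ʳ (replicate (suc (j + j)) 1) (map⁻ digits)) refl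
    where
    ones = replicate (suc (j + j)) 1
    word = ones ++ replicate (suc (k + k)) 0 ++ [ 1 ]
    canonical : Canonical⁺ d word
    canonical = prepend (replicate⁺ (suc (j + j)) 1<d) (prepend (replicate⁺ (suc (k + k)) 0<d) (top (s≤s z≤n) 1<d))
    value : val d word ≡ d ^ ((j + suc k) + (j + suc k)) + val d ones
    value = begin
      val d word                                                       ≡⟨ val-++ d ones _ ⟩
      val d ones + d ^ length ones * val d (replicate (suc (k + k)) 0 ++ [ 1 ])
        ≡⟨ cong₂ (λ n v → val d ones + d ^ n * v) (length-replicate (suc (j + j))) (val-monomial d (suc (k + k)) 1) ⟩
      val d ones + d ^ suc (j + j) * (d ^ suc (k + k) * 1)             ≡⟨ cong (λ v → val d ones + d ^ suc (j + j) * v) (*-identityʳ _) ⟩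
      val d ones + d ^ suc (j + j) * d ^ suc (k + k)                   ≡⟨ cong (λ n → val d ones + n) (sym (^-distribˡ-+-* d (suc (j + j)) (suc (k + k)))) ⟩
      val d ones + d ^ (suc (j + j) + suc (k + k))                     ≡⟨ cong (λ e → val d ones + d ^ e) (sym (odd-split j k)) ⟩
      val d ones + d ^ ((j + suc k) + (j + suc k))                     ≡⟨ +-comm (val d ones) _ ⟩
      d ^ ((j + suc k) + (j + suc k)) + val d ones                     ∎
    digits : NonzeroDigits (map toℤ word)
    digits = subst NonzeroDigits (rep-val 2≤d canonical) (subst (NonzeroDigits ∘ rep d ∘ toℤ) (sym value) h)

even-length-unstable : (d : ℕ) → 2 ≤ d → Unstable (λ a → 2 ∣ length (rep d a))
even-length-unstable d 2≤d =
  two-digit-unstable (λ L → 2 ∣ length L) 2≤d (s≤s z≤n) 2≤d (s≤s z≤n) 2≤d holds fails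
  where
  even-length : ∀ i k → (i + i) + suc ((k + k) + 1) ≡ suc (i + k) + suc (i + k)
  even-length = solve-∀
  odd-length : ∀ j k → suc (j + j) + suc ((k + k) + 1) ≡ suc (suc (j + k) + suc (j + k))
  odd-length = solve-∀
  holds : ∀ i k → 2 ∣ length (spaced 0ℤ (i + i) 1ℤ (k + k) 1ℤ)
  holds i k = subst (2 ∣_) (sym (trans (length-spaced 0ℤ (i + i) 1ℤ (k + k) 1ℤ) (even-length i k))) (even (suc (i + k)))
  fails : ∀ j k → ¬ 2 ∣ length (spaced 0ℤ (suc (j + j)) 1ℤ (k + k) 1ℤ)
  fails j k = odd-not-even (suc (j + k)) ∘ subst (2 ∣_) (trans (length-spaced 0ℤ (suc (j + j)) 1ℤ (k + k) 1ℤ) (odd-length j k))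

-- (iv) In base 2, 0^(2i) 1 0^(2k) 1 is a Blocks word, while 0^(2j+1) 1 0^(2k) 1
-- starts with an odd run of zeros.
blocks-unstable : Unstable (λ a → Blocks 1ℤ (rep 2 a) ⊎ Blocks -1ℤ (rep 2 a))
blocks-unstable =
  two-digit-unstable (λ L → Blocks 1ℤ L ⊎ Blocks -1ℤ L) ≤-refl (s≤s z≤n) ≤-refl (s≤s z≤n) ≤-refl holds fails
  where
  holds : ∀ i k → Blocks 1ℤ (spaced 0ℤ (i + i) 1ℤ (k + k) 1ℤ) ⊎ _
  holds i k = inj₁ (more (i + i) (even i) (one (k + k) (even k)))
  leading : ∀ {s} j k → Blocks s (spaced 0ℤ (suc (j + j)) 1ℤ (k + k) 1ℤ) → s ≢ 0ℤ → 2 ∣ suc (j + j) × s ≡ 1ℤ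
  leading j k b s≢0 = blocks-leading-zeros (suc (j + j)) _ s≢0 (λ ()) b
  -1≢1 : -1ℤ ≢ 1ℤ
  -1≢1 ()
  fails : ∀ j k → ¬ (Blocks 1ℤ (spaced 0ℤ (suc (j + j)) 1ℤ (k + k) 1ℤ) ⊎ Blocks -1ℤ _)
  fails j k (inj₁ b) = odd-not-even j (proj₁ (leading j k b (λ ())))
  fails j k (inj₂ b) = -1≢1 (proj₂ (leading j k b (λ ())))

corollary4p8 : ((d : ℕ) → 2 < d → Unstable (λ a → (last (rep d a) ≡ just 1ℤ) ⊎ (last (rep d a) ≡ just -1ℤ)))
    × ((d : ℕ) → 2 < d → Unstable (λ a → All (λ k → k ≢ 0ℤ) (rep d a)))
    × ((d : ℕ) → 2 ≤ d → Unstable (λ a → 2 ∣ length (rep d a)))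
    × Unstable (λ a → Blocks 1ℤ (rep 2 a) ⊎ Blocks -1ℤ (rep 2 a))
corollary4p8 = last-digit-unstable , nonzero-digits-unstable , even-length-unstable , blocks-unstable
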